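{- Let $\Delta$ be the boundary complex of a balanced simplicial $d$-polytope and $v$ a vertex of $\Delta$. Then there exists a vertex $u\neq v$ of $\Delta$ such that $uv$ is not an edge of $\Delta$.
   Context: A simplicial $d$-polytope is balanced if the $1$-skeleton of its boundary complex admits a proper vertex coloring with $d$ colors.
   Formalization: The vertices of the balanced simplicial d-polytope have rational coordinates. -}

module Defs where

open import Data.Nat using (ℕ; zero; suc)
open import Data.Fin using (Fin; zero; suc)
open import Data.Rational using (ℚ; 0ℚ; _+_; _*_; _≤_)
open import Data.Product using (_×_; ∃; _,_)
open import Data.Sum using (_⊎_)
open import Relation.Binary.PropositionalEquality using (_≡_; _≢_)
open import Relation.Nullary using (¬_)

Point : ℕ → Set
Point d = Fin d → ℚ

∑ : ∀ {n} → (Fin n → ℚ) → ℚ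
∑ {zero}  f = 0ℚ
∑ {suc n} f = f zero + ∑ (λ i → f (suc i))

_·_ : ∀ {d} → Point d → Point d → ℚ
a · x = ∑ (λ k → a k * x k)

_⇔_ : Set → Set → Set
A ⇔ B = (A → B) × (B → A)

-- The polytope under consideration is P = conv {p i | i : Fin n}.
-- A supporting hyperplane {x | a·x = b} with a ≠ 0 and a·x ≤ b on P.
-- Its intersection with P is a proper face of P (every proper face,
-- including the empty face, arises this way).
record Supporting {d n : ℕ} (p : Fin n → Point d) : Set where
  constructor hyp
  field
    normal  : Point d
    offset  : ℚ
    nonzero : ¬ (∀ k → normal k ≡ 0ℚ)
    below   : ∀ i → normal · p i ≤ offset

On : ∀ {d n} {p : Fin n → Point d} → Supporting p → Fin n → Set
On {p = p} H i = Supporting.normal H · p i ≡ Supporting.offset H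

IsVertex : ∀ {d n} (p : Fin n → Point d) → Fin n → Set
IsVertex p i = ∃ λ (H : Supporting p) → ∀ k → On H k ⇔ (k ≡ i)

IsEdge : ∀ {d n} (p : Fin n → Point d) → Fin n → Fin n → Set
IsEdge p i j = i ≢ j × (∃ λ (H : Supporting p) → ∀ k → On H k ⇔ (k ≡ i ⊎ k ≡ j))

AffinelyIndependent : ∀ {d n} (p : Fin n → Point d) → (Fin n → Set) → Set
AffinelyIndependent {d} {n} p S =
  (λ′ : Fin n → ℚ) → (∀ i → ¬ S i → λ′ i ≡ 0ℚ) →
  ∑ λ′ ≡ 0ℚ → (∀ k → ∑ (λ i → λ′ i * p i k) ≡ 0ℚ) →
  ∀ i → λ′ i ≡ 0ℚ

FullDimensional : ∀ {d n} (p : Fin n → Point d) → Set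
FullDimensional {d} {n} p =
  (a : Point d) (b : ℚ) → (∀ i → a · p i ≡ b) → ∀ k → a k ≡ 0ℚ

record SimplicialPolytope (d n : ℕ) (p : Fin n → Point d) : Set where
  field
    allVertices : ∀ i → IsVertex p i
    fullDim     : FullDimensional p
    simplicial  : (H : Supporting p) → AffinelyIndependent p (On H)

Balanced : (d n : ℕ) (p : Fin n → Point d) → Set
Balanced d n p = ∃ λ (c : Fin n → Fin d) → ∀ i j → IsEdge p i j → c i ≢ c j

{-# OPTIONS --safe #-}
module Submission where

-- Push a supporting hyperplane off the polytope and rotate it d times.  Each
-- rotation pivots about v and the vertices collected so far: there are at most
-- d of these points, so some non-constant affine functional vanishes on all of
-- them, and tilting the hyperplane by it until it meets a new vertex keeps v
-- strictly on one side.  This yields a face containing d distinct vertices but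
-- not v.  In a simplicial polytope every nonempty subset of the vertices of a
-- face spans a face, so these d vertices are pairwise adjacent; a proper
-- d-colouring therefore uses every colour on them, and the one coloured like v
-- is not adjacent to v.

open import Defs
open import Algebra.Bundles using (CommutativeRing)
import Algebra.Properties.Group as GroupProperties
import Algebra.Properties.Semiring.Sum as SemiringSum
open import Data.Empty using (⊥-elim)
open import Data.Fin as Fin using (Fin; zero; suc; punchOut)
open import Data.Fin.Properties as FinP using (any?; all?; ¬∀⟶∃¬; punchOut-injective; injective⇒≤)
open import Data.List as List using (List; []; filter; allFin)
open import Data.List.Membership.Propositional using (_∉_)
open import Data.List.Membership.Propositional.Properties using (∈-filter⁺; ∈-filter⁻; ∈-allFin)
import Data.List.Relation.Unary.All as All
open import Data.List.Relation.Unary.All.Properties using (all-filter)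
open import Data.List.Relation.Unary.Any using (here; there)
open import Data.Nat as ℕ using (ℕ; zero; suc; s≤s)
open import Data.Nat.Properties as ℕP using (n≮n)
open import Data.Product using (Σ; ∃; ∃₂; _×_; _,_; proj₁; proj₂; map₁)
open import Data.Rational as ℚ using (ℚ; 0ℚ; 1ℚ; _+_; _*_; -_; _-_; _≤_; _<_; 1/_)
open import Data.Rational.Properties as ℚP using (_≟_; _<?_)
open import Data.Rational.Solver using (module +-*-Solver)
open import Data.Sum as Sum using (_⊎_; inj₁; inj₂)
open import Data.Vec.Functional using (_∷_; head; tail)
open import Function using (_∘_; id)
open import Function.Definitions using (Injective)
open import Relation.Binary.Bundles using (DecTotalOrder)
open import Relation.Binary.Definitions using (tri<; tri≈; tri>)
open import Relation.Binary.PropositionalEquality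
open import Relation.Nullary using (¬_; Dec; yes; no; contradiction)
open import Relation.Nullary.Decidable using (¬?; _×-dec_; _⊎-dec_; decidable-stable)
open import Relation.Unary using (Decidable)

open import Data.List.Extrema (DecTotalOrder.totalOrder ℚP.≤-decTotalOrder)
  using (argmin; argmin-all; f[argmin]≤f[xs])
open +-*-Solver using (solve; _:=_; con; _:+_; _:*_; _:-_; :-_)
open GroupProperties ℚP.+-0-group using (inverseʳ-unique; x∙y⁻¹≈ε⇒x≈y; x≈y⇒x∙y⁻¹≈ε)
open SemiringSum (CommutativeRing.semiring ℚP.+-*-commutativeRing)
  using (sum; sum-cong-≗; sum-replicate-zero; ∑-distrib-+; *-distribˡ-sum)

∑≡sum : ∀ {n} (f : Fin n → ℚ) → ∑ f ≡ sum f
∑≡sum {zero}  f = refl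
∑≡sum {suc n} f = cong (f zero +_) (∑≡sum (f ∘ suc))

∑-cong : ∀ {n} {f g : Fin n → ℚ} → (∀ i → f i ≡ g i) → ∑ f ≡ ∑ g
∑-cong {n} {f} {g} f≗g = trans (∑≡sum f) (trans (sum-cong-≗ {n} f≗g) (sym (∑≡sum g)))

∑-zero : ∀ {n} {f : Fin n → ℚ} → (∀ i → f i ≡ 0ℚ) → ∑ f ≡ 0ℚ
∑-zero {n} f≗0 = trans (∑-cong f≗0) (trans (∑≡sum {n} (λ _ → 0ℚ)) (sum-replicate-zero n))

∑-*ˡ : ∀ {n} (c : ℚ) (f : Fin n → ℚ) → ∑ (λ i → c * f i) ≡ c * ∑ f
∑-*ˡ {n} c f = trans (∑≡sum {n} _) (trans (sym (*-distribˡ-sum {n} c f)) (cong (c *_) (sym (∑≡sum f))))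

∑-+ : ∀ {n} (f g : Fin n → ℚ) → ∑ (λ i → f i + g i) ≡ ∑ f + ∑ g
∑-+ {n} f g = trans (∑≡sum {n} _) (trans (∑-distrib-+ {n} f g) (sym (cong₂ _+_ (∑≡sum f) (∑≡sum g))))

∑-linear : ∀ {n} (f g : Fin n → ℚ) (c : ℚ) → ∑ (λ i → f i + c * g i) ≡ ∑ f + c * ∑ g
∑-linear f g c = trans (∑-+ f (λ i → c * g i)) (cong (∑ f +_) (∑-*ˡ c g))

δ : ∀ {n} → Fin n → Fin n → ℚ
δ zero    zero    = 1ℚ
δ zero    (suc _) = 0ℚ
δ (suc _) zero    = 0ℚ
δ (suc r) (suc s) = δ r s

δ-diag : ∀ {n} (r : Fin n) → δ r r ≡ 1ℚ
δ-diag zero    = refl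
δ-diag (suc r) = δ-diag r

δ-offdiag : ∀ {n} {r s : Fin n} → r ≢ s → δ r s ≡ 0ℚ
δ-offdiag {r = zero}  {zero}  r≢s = contradiction refl r≢s
δ-offdiag {r = zero}  {suc s} _   = refl
δ-offdiag {r = suc r} {zero}  _   = refl
δ-offdiag {r = suc r} {suc s} r≢s = δ-offdiag (r≢s ∘ cong suc)

∑-δ : ∀ {n} (r : Fin n) (f : Fin n → ℚ) → ∑ (λ s → δ r s * f s) ≡ f r
∑-δ zero f = trans (cong₂ _+_ (ℚP.*-identityˡ (f zero)) (∑-zero (λ i → ℚP.*-zeroˡ (f (suc i)))))
                   (ℚP.+-identityʳ (f zero))
∑-δ (suc r) f = trans (cong (_+ ∑ (λ s → δ r s * f (suc s))) (ℚP.*-zeroˡ (f zero)))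
                      (trans (ℚP.+-identityˡ _) (∑-δ r (f ∘ suc)))

∑-minus-δ : ∀ {n} (r : Fin n) (f g : Fin n → ℚ) → ∑ (λ s → f s - δ r s * g s) ≡ ∑ f - g r
∑-minus-δ r f g = begin
  ∑ (λ s → f s - δ r s * g s)             ≡⟨ ∑-cong (λ s → minus (f s) (δ r s * g s)) ⟩
  ∑ (λ s → f s + (- 1ℚ) * (δ r s * g s)) ≡⟨ ∑-linear f (λ s → δ r s * g s) (- 1ℚ) ⟩
  ∑ f + (- 1ℚ) * ∑ (λ s → δ r s * g s)   ≡⟨ cong (λ x → ∑ f + (- 1ℚ) * x) (∑-δ r g) ⟩
  ∑ f + (- 1ℚ) * g r                     ≡⟨ minus (∑ f) (g r) ⟨
  ∑ f - g r                               ∎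
  where
  open ≡-Reasoning
  minus : ∀ a b → a - b ≡ a + (- 1ℚ) * b
  minus = solve 2 (λ a b → a :- b := a :+ (:- con 1ℚ) :* b) refl

indicator : ∀ {A : Set} → Dec A → ℚ
indicator (yes _) = 1ℚ
indicator (no _)  = 0ℚ

indicator-yes : ∀ {A : Set} → A → (a? : Dec A) → indicator a? ≡ 1ℚ
indicator-yes a (yes _) = refl
indicator-yes a (no ¬a) = contradiction a ¬a

indicator-no : ∀ {A : Set} → ¬ A → (a? : Dec A) → indicator a? ≡ 0ℚ
indicator-no ¬a (yes a) = contradiction a ¬a
indicator-no ¬a (no _)  = refl

-- the multiplicative inverse, extended by inv 0 = 0
inv : ℚ → ℚ
inv p with p ≟ 0ℚ
... | yes _   = 0ℚ
... | no p≢0  = 1/_ p {{ℚ.≢-nonZero p≢0}}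

*-inv : ∀ {p} → p ≢ 0ℚ → p * inv p ≡ 1ℚ
*-inv {p} p≢0 with p ≟ 0ℚ
... | yes p≡0  = contradiction p≡0 p≢0
... | no p≢0′ = ℚP.*-inverseʳ p {{ℚ.≢-nonZero p≢0′}}

inv-pos : ∀ {p} → 0ℚ < p → 0ℚ < inv p
inv-pos {p} 0<p with p ≟ 0ℚ
... | yes p≡0 = contradiction (sym p≡0) (ℚP.<⇒≢ 0<p)
... | no _    = ℚP.positive⁻¹ _ {{ℚP.1/pos⇒pos p {{ℚ.positive 0<p}}}}

p≤q⇒0≤q-p : ∀ {p q} → p ≤ q → 0ℚ ≤ q - p
p≤q⇒0≤q-p {p} {q} p≤q = subst (_≤ q - p) (ℚP.+-inverseʳ p) (ℚP.+-monoˡ-≤ (- p) p≤q)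

p<q⇒0<q-p : ∀ {p q} → p < q → 0ℚ < q - p
p<q⇒0<q-p {p} {q} p<q = subst (_< q - p) (ℚP.+-inverseʳ p) (ℚP.+-monoˡ-< (- p) p<q)

0≤q-p⇒p≤q : ∀ {p q} → 0ℚ ≤ q - p → p ≤ q
0≤q-p⇒p≤q {p} {q} 0≤q-p = subst₂ _≤_ (ℚP.+-identityˡ p) (cancel q p) (ℚP.+-monoˡ-≤ p 0≤q-p)
  where
  cancel : ∀ q p → (q - p) + p ≡ q
  cancel = solve 2 (λ q p → (q :- p) :+ p := q) refl

0≤*0≤ : ∀ {a b} → 0ℚ ≤ a → 0ℚ ≤ b → 0ℚ ≤ a * b
0≤*0≤ {a} {b} 0≤a 0≤b = ℚP.nonNegative⁻¹ _
  {{ℚP.nonNeg*nonNeg⇒nonNeg a {{ℚ.nonNegative 0≤a}} b {{ℚ.nonNegative 0≤b}}}}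

0<*0< : ∀ {a b} → 0ℚ < a → 0ℚ < b → 0ℚ < a * b
0<*0< {a} {b} 0<a 0<b = ℚP.positive⁻¹ _ {{ℚP.pos*pos⇒pos a {{ℚ.positive 0<a}} b {{ℚ.positive 0<b}}}}

-- Affine functionals: g : Point (suc d) acts on Point d by x ↦ g · lift x.

lift : ∀ {d} → Point d → Point (suc d)
lift x = 1ℚ ∷ x

Nonzero : ∀ {d} → Point d → Set
Nonzero g = ¬ (∀ k → g k ≡ 0ℚ)

scale : ∀ {d} → ℚ → Point d → Point d
scale c x k = c * x k

·-zeroˡ : ∀ {d} {g : Point d} (x : Point d) → (∀ k → g k ≡ 0ℚ) → g · x ≡ 0ℚ
·-zeroˡ x g≗0 = ∑-zero (λ k → trans (cong (_* x k) (g≗0 k)) (ℚP.*-zeroˡ (x k)))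

·-zeroʳ : ∀ {d} (g : Point d) {x : Point d} → (∀ k → x k ≡ 0ℚ) → g · x ≡ 0ℚ
·-zeroʳ g x≗0 = ∑-zero (λ k → trans (cong (g k *_) (x≗0 k)) (ℚP.*-zeroʳ (g k)))

·-scaleˡ : ∀ {d} (c : ℚ) (g x : Point d) → scale c g · x ≡ c * (g · x)
·-scaleˡ c g x = trans (∑-cong (λ k → ℚP.*-assoc c (g k) (x k))) (∑-*ˡ c (λ k → g k * x k))

·-scaleʳ : ∀ {d} (c : ℚ) (g x : Point d) → g · scale c x ≡ c * (g · x)
·-scaleʳ c g x = trans (∑-cong (λ k → swap (g k) c (x k))) (∑-*ˡ c (λ k → g k * x k))
  where
  swap : ∀ a b c → a * (b * c) ≡ b * (a * c)
  swap = solve 3 (λ a b c → a :* (b :* c) := b :* (a :* c)) refl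

·-linearˡ : ∀ {d} (a b x : Point d) (c : ℚ) → (λ k → a k + c * b k) · x ≡ a · x + c * (b · x)
·-linearˡ a b x c = trans (∑-cong (λ k → distrib (a k) c (b k) (x k))) (∑-linear (λ k → a k * x k) (λ k → b k * x k) c)
  where
  distrib : ∀ a c b x → (a + c * b) * x ≡ a * x + c * (b * x)
  distrib = solve 4 (λ a c b x → (a :+ c :* b) :* x := a :* x :+ c :* (b :* x)) refl

·-minusʳ : ∀ {d} (g x y : Point d) (c : ℚ) → g · (λ k → x k - c * y k) ≡ g · x - c * (g · y)
·-minusʳ g x y c = begin
  g · (λ k → x k - c * y k)                    ≡⟨ ∑-cong (λ k → distrib (g k) (x k) c (y k)) ⟩
  ∑ (λ k → g k * x k + (- c) * (g k * y k))   ≡⟨ ∑-linear (λ k → g k * x k) (λ k → g k * y k) (- c) ⟩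
  g · x + (- c) * (g · y)                      ≡⟨ minus (g · x) c (g · y) ⟩
  g · x - c * (g · y)                          ∎
  where
  open ≡-Reasoning
  distrib : ∀ g x c y → g * (x - c * y) ≡ g * x + (- c) * (g * y)
  distrib = solve 4 (λ g x c y → g :* (x :- c :* y) := g :* x :+ (:- c) :* (g :* y)) refl
  minus : ∀ a c b → a + (- c) * b ≡ a - c * b
  minus = solve 3 (λ a c b → a :+ (:- c) :* b := a :- c :* b) refl

InSpan : ∀ {d m} → (Fin m → Point d) → Point d → Set
InSpan {m = m} w x = ∃ λ (l : Fin m → ℚ) → ∀ j → x j ≡ ∑ (λ r → l r * w r j)

Separates : ∀ {d m} → Point d → (Fin m → Point d) → Point d → Set
Separates g w x = (∀ r → g · w r ≡ 0ℚ) × g · x ≡ 1ℚ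

module Pivot {d m} (w : Fin m → Point (suc d)) (r : Fin m) (pivot≢0 : head (w r) ≢ 0ℚ) where

  ι : ℚ
  ι = inv (head (w r))

  clear : Point (suc d) → Point (suc d)
  clear v j = v j - (head v * ι) * w r j

  clear-head : ∀ v → head (clear v) ≡ 0ℚ
  clear-head v = begin
    head v - (head v * ι) * head (w r)    ≡⟨ regroup (head v) ι (head (w r)) ⟩
    head v - head v * (head (w r) * ι)    ≡⟨ cong (λ x → head v - head v * x) (*-inv pivot≢0) ⟩
    head v - head v * 1ℚ                  ≡⟨ vanish (head v) ⟩
    0ℚ                                    ∎
    where
    open ≡-Reasoning
    regroup : ∀ a ι u → a - (a * ι) * u ≡ a - a * (u * ι)
    regroup = solve 3 (λ a ι u → a :- (a :* ι) :* u := a :- a :* (u :* ι)) refl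
    vanish : ∀ a → a - a * 1ℚ ≡ 0ℚ
    vanish = solve 1 (λ a → a :- a :* con 1ℚ := con 0ℚ) refl

  reduce : Point (suc d) → Point d
  reduce v = tail (clear v)

  reduce-pivot : ∀ j → reduce (w r) j ≡ 0ℚ
  reduce-pivot j = trans (cong (λ x → w r (suc j) - x * w r (suc j)) (*-inv pivot≢0)) (vanish (w r (suc j)))
    where
    vanish : ∀ a → a - 1ℚ * a ≡ 0ℚ
    vanish = solve 1 (λ a → a :- con 1ℚ :* a := con 0ℚ) refl

  extend : Point d → Point (suc d)
  extend g = (- (g · tail (w r)) * ι) ∷ g

  extend-· : ∀ g v → extend g · v ≡ g · reduce v
  extend-· g v = trans (regroup (g · tail (w r)) ι (head v) (g · tail v))
                       (sym (·-minusʳ g (tail v) (tail (w r)) (head v * ι)))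
    where
    regroup : ∀ G ι a A → - G * ι * a + A ≡ A - (a * ι) * G
    regroup = solve 4 (λ G ι a A → :- G :* ι :* a :+ A := A :- (a :* ι) :* G) refl

  span-unreduce : ∀ {x} → InSpan (reduce ∘ w) (reduce x) → InSpan w x
  span-unreduce {x} (l , reduce-x≡) = μ , x≡
    where
    α : Fin m → ℚ
    α s = head (w s) * ι
    L : ℚ
    L = ∑ (λ s → l s * α s)
    β : ℚ
    β = head x * ι
    μ : Fin m → ℚ
    μ s = l s + δ r s * (β - L)
    clear-x≡ : ∀ j → clear x j ≡ ∑ (λ s → l s * clear (w s) j)
    clear-x≡ zero    = trans (clear-head x) (sym (∑-zero (λ s → trans (cong (l s *_) (clear-head (w s))) (ℚP.*-zeroʳ (l s)))))
    clear-x≡ (suc j) = reduce-x≡ j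
    x≡ : ∀ j → x j ≡ ∑ (λ s → μ s * w s j)
    x≡ j = begin
      x j                                              ≡⟨ unclear (x j) β (w r j) ⟩
      clear x j + β * w r j                            ≡⟨ cong (_+ β * w r j) (clear-x≡ j) ⟩
      ∑ (λ s → l s * clear (w s) j) + β * w r j        ≡⟨ cong (_+ β * w r j) cleared-sum ⟩
      (∑ (λ s → l s * w s j) + (- w r j) * L) + β * w r j ≡⟨ collect (∑ (λ s → l s * w s j)) (w r j) L β ⟩
      ∑ (λ s → l s * w s j) + (β - L) * w r j          ≡⟨ cong (λ y → ∑ (λ s → l s * w s j) + (β - L) * y) (∑-δ r (λ s → w s j)) ⟨
      ∑ (λ s → l s * w s j) + (β - L) * ∑ (λ s → δ r s * w s j)
                                                       ≡⟨ ∑-linear (λ s → l s * w s j) (λ s → δ r s * w s j) (β - L) ⟨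
      ∑ (λ s → l s * w s j + (β - L) * (δ r s * w s j)) ≡⟨ ∑-cong (λ s → distrib (l s) (δ r s) (β - L) (w s j)) ⟩
      ∑ (λ s → μ s * w s j)                            ∎
      where
      open ≡-Reasoning
      cleared-sum : ∑ (λ s → l s * clear (w s) j) ≡ ∑ (λ s → l s * w s j) + (- w r j) * L
      cleared-sum = trans (∑-cong (λ s → expand (l s) (w s j) (α s) (w r j)))
                          (∑-linear (λ s → l s * w s j) (λ s → l s * α s) (- w r j))
        where
        expand : ∀ l a α u → l * (a - α * u) ≡ l * a + (- u) * (l * α)
        expand = solve 4 (λ l a α u → l :* (a :- α :* u) := l :* a :+ (:- u) :* (l :* α)) refl
      unclear : ∀ a β u → a ≡ (a - β * u) + β * u
      unclear = solve 3 (λ a β u → a := (a :- β :* u) :+ β :* u) refl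
      collect : ∀ S u L β → (S + (- u) * L) + β * u ≡ S + (β - L) * u
      collect = solve 4 (λ S u L β → (S :+ (:- u) :* L) :+ β :* u := S :+ (β :- L) :* u) refl
      distrib : ∀ l δ c a → l * a + c * (δ * a) ≡ (l + δ * c) * a
      distrib = solve 4 (λ l δ c a → l :* a :+ c :* (δ :* a) := (l :+ δ :* c) :* a) refl

·-first : ∀ {d} (c : ℚ) (v : Point (suc d)) → (c ∷ (λ _ → 0ℚ)) · v ≡ c * head v
·-first c v = trans (cong (c * head v +_) (·-zeroˡ (tail v) (λ _ → refl))) (ℚP.+-identityʳ (c * head v))

pivot? : ∀ {d m} (w : Fin m → Point (suc d)) → (∃ λ r → head (w r) ≢ 0ℚ) ⊎ (∀ r → head (w r) ≡ 0ℚ)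
pivot? {m = m} w with all? (λ r → head (w r) ≟ 0ℚ)
... | yes heads≡0 = inj₂ heads≡0
... | no ¬heads≡0 = inj₁ (¬∀⟶∃¬ m _ (λ r → head (w r) ≟ 0ℚ) ¬heads≡0)

homogeneous-solution : ∀ {d m} → m ℕ.< d → (w : Fin m → Point d) →
                       ∃ λ g → Nonzero g × ∀ r → g · w r ≡ 0ℚ
homogeneous-solution {suc d} m<d w with pivot? w
... | inj₂ heads≡0 = 1ℚ ∷ (λ _ → 0ℚ) , (λ g≡0 → ℚP.1≢0 (g≡0 zero)) ,
                     λ r → trans (·-first 1ℚ (w r)) (trans (ℚP.*-identityˡ _) (heads≡0 r))
homogeneous-solution {suc d} {suc m} (s≤s m<d) w | inj₁ (r , pivot≢0) = solution (homogeneous-solution m<d w′)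
  where
  open Pivot w r pivot≢0
  w′ : Fin m → Point d
  w′ i = reduce (w (Fin.punchIn r i))
  solution : (∃ λ g → Nonzero g × ∀ i → g · w′ i ≡ 0ℚ) → ∃ λ g → Nonzero g × ∀ s → g · w s ≡ 0ℚ
  solution (g , g≢0 , g⊥w′) = extend g , (λ g′≡0 → g≢0 (g′≡0 ∘ suc)) , λ s → trans (extend-· g (w s)) (reduced s)
    where
    reduced : ∀ s → g · reduce (w s) ≡ 0ℚ
    reduced s with r Fin.≟ s
    ... | yes refl = ·-zeroʳ g reduce-pivot
    ... | no r≢s   = subst (λ t → g · reduce (w t) ≡ 0ℚ) (FinP.punchIn-punchOut r≢s) (g⊥w′ (punchOut r≢s))

span-or-separated : ∀ {d m} (w : Fin m → Point d) (x : Point d) → InSpan w x ⊎ ∃ λ g → Separates g w x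
span-or-separated {zero} w x = inj₁ ((λ _ → 0ℚ) , λ ())
span-or-separated {suc d} w x with pivot? w
... | inj₁ (r , pivot≢0) = Sum.map span-unreduce separated (span-or-separated (reduce ∘ w) (reduce x))
  where
  open Pivot w r pivot≢0
  separated : (∃ λ g → Separates g (reduce ∘ w) (reduce x)) → ∃ λ g → Separates g w x
  separated (g , g⊥w , g·x≡1) = extend g , (λ s → trans (extend-· g (w s)) (g⊥w s)) , trans (extend-· g x) g·x≡1
... | inj₂ heads≡0 with head x ≟ 0ℚ
...   | no x₀≢0 = inj₂ (x₀⁻¹ ∷ (λ _ → 0ℚ) ,
                          (λ r → trans (·-first x₀⁻¹ (w r)) (trans (cong (x₀⁻¹ *_) (heads≡0 r)) (ℚP.*-zeroʳ x₀⁻¹))) ,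
                          trans (·-first x₀⁻¹ x) (trans (ℚP.*-comm x₀⁻¹ (head x)) (*-inv x₀≢0)))
    where
    x₀⁻¹ : ℚ
    x₀⁻¹ = inv (head x)
...   | yes x₀≡0 = Sum.map span-tail separated-tail (span-or-separated (tail ∘ w) (tail x))
  where
  span-tail : InSpan (tail ∘ w) (tail x) → InSpan w x
  span-tail (l , tail-x≡) = l , λ { zero → trans x₀≡0 (sym (∑-zero (λ r → trans (cong (l r *_) (heads≡0 r)) (ℚP.*-zeroʳ (l r))))) ; (suc j) → tail-x≡ j }
  zero-head : ∀ g v → (0ℚ ∷ g) · v ≡ g · tail v
  zero-head g v = trans (cong (_+ g · tail v) (ℚP.*-zeroˡ (head v))) (ℚP.+-identityˡ (g · tail v))
  separated-tail : (∃ λ g → Separates g (tail ∘ w) (tail x)) → ∃ λ g → Separates g w x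
  separated-tail (g , g⊥w , g·x≡1) = 0ℚ ∷ g , (λ r → trans (zero-head g (w r)) (g⊥w r)) , trans (zero-head g x) g·x≡1

minus-ratio : ∀ {ψ} → 0ℚ < ψ → ∀ D t → D - t * ψ ≡ (D * inv ψ - t) * ψ
minus-ratio {ψ} 0<ψ D t = begin
  D - t * ψ                 ≡⟨ cong (λ x → x - t * ψ) (ℚP.*-identityʳ D) ⟨
  D * 1ℚ - t * ψ            ≡⟨ cong (λ x → D * x - t * ψ) (*-inv (ℚP.<⇒≢ 0<ψ ∘ sym)) ⟨
  D * (ψ * inv ψ) - t * ψ   ≡⟨ regroup D ψ (inv ψ) t ⟩
  (D * inv ψ - t) * ψ       ∎
  where
  open ≡-Reasoning
  regroup : ∀ D ψ ι t → D * (ψ * ι) - t * ψ ≡ (D * ι - t) * ψ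
  regroup = solve 4 (λ D ψ ι t → D :* (ψ :* ι) :- t :* ψ := (D :* ι :- t) :* ψ) refl

t≤D/ψ⇒0≤D-tψ : ∀ {D ψ t} → 0ℚ < ψ → t ≤ D * inv ψ → 0ℚ ≤ D - t * ψ
t≤D/ψ⇒0≤D-tψ {D} {ψ} {t} 0<ψ t≤D/ψ =
  subst (0ℚ ≤_) (sym (minus-ratio 0<ψ D t)) (0≤*0≤ (p≤q⇒0≤q-p t≤D/ψ) (ℚP.<⇒≤ 0<ψ))

t<D/ψ⇒0<D-tψ : ∀ {D ψ t} → 0ℚ < ψ → t < D * inv ψ → 0ℚ < D - t * ψ
t<D/ψ⇒0<D-tψ {D} {ψ} {t} 0<ψ t<D/ψ =
  subst (0ℚ <_) (sym (minus-ratio 0<ψ D t)) (0<*0< (p<q⇒0<q-p t<D/ψ) 0<ψ)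

D≤D-tψ : ∀ {D ψ t} → 0ℚ ≤ t → ψ ≤ 0ℚ → D ≤ D - t * ψ
D≤D-tψ {D} {ψ} {t} 0≤t ψ≤0 =
  subst (_≤ D - t * ψ) (ℚP.+-identityʳ D) (ℚP.+-monoʳ-≤ D (ℚP.neg-antimono-≤ tψ≤0))
  where
  tψ≤0 : t * ψ ≤ 0ℚ
  tψ≤0 = subst (t * ψ ≤_) (ℚP.*-zeroʳ t) (ℚP.*-monoˡ-≤-nonNeg t {{ℚ.nonNegative 0≤t}} ψ≤0)

argmin-on : ∀ {m} {P : Fin m → Set} → Decidable P → (f : Fin m → ℚ) → ∃ P →
            ∃ λ k₀ → P k₀ × ∀ k → P k → f k₀ ≤ f k
argmin-on {m} {P} P? f (k , Pk) = k₀ , argmin-all f Pk (all-filter P? (allFin m)) , minimal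
  where
  candidates : List (Fin m)
  candidates = filter P? (allFin m)
  k₀ : Fin m
  k₀ = argmin f k candidates
  minimal : ∀ k′ → P k′ → f k₀ ≤ f k′
  minimal k′ Pk′ = All.lookup (f[argmin]≤f[xs] {f = f} k candidates) (∈-filter⁺ P? (∈-allFin k′) Pk′)

max-step : ∀ {n} (D ψ : Fin n → ℚ) → (∀ k → 0ℚ ≤ D k) → ∃ (λ k → 0ℚ < ψ k) →
           ∃₂ λ t k₀ → 0ℚ < ψ k₀ × D k₀ - t * ψ k₀ ≡ 0ℚ × ∀ k → 0ℚ ≤ D k - t * ψ k
max-step D ψ 0≤D some-ψ>0 = from-min (argmin-on (λ k → 0ℚ <? ψ k) (λ k → D k * inv (ψ k)) some-ψ>0)
  where
  from-min : (∃ λ k₀ → 0ℚ < ψ k₀ × ∀ k → 0ℚ < ψ k → D k₀ * inv (ψ k₀) ≤ D k * inv (ψ k)) →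
             ∃₂ λ t k₀ → 0ℚ < ψ k₀ × D k₀ - t * ψ k₀ ≡ 0ℚ × ∀ k → 0ℚ ≤ D k - t * ψ k
  from-min (k₀ , 0<ψk₀ , minimal) = t , k₀ , 0<ψk₀ , tight , nonneg
    where
    t : ℚ
    t = D k₀ * inv (ψ k₀)
    tight : D k₀ - t * ψ k₀ ≡ 0ℚ
    tight = trans (minus-ratio 0<ψk₀ (D k₀) t) (trans (cong (_* ψ k₀) (ℚP.+-inverseʳ t)) (ℚP.*-zeroˡ (ψ k₀)))
    nonneg : ∀ k → 0ℚ ≤ D k - t * ψ k
    nonneg k with 0ℚ <? ψ k
    ... | yes 0<ψk = t≤D/ψ⇒0≤D-tψ {D k} 0<ψk (minimal k 0<ψk)
    ... | no 0≮ψk  = ℚP.≤-trans (0≤D k) (D≤D-tψ (0≤*0≤ (0≤D k₀) (ℚP.<⇒≤ (inv-pos 0<ψk₀))) (ℚP.≮⇒≥ 0≮ψk))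

small-step : ∀ {n} (D ψ : Fin n → ℚ) → ∃ λ t → 0ℚ < t × ∀ k → 0ℚ < D k → 0ℚ < D k - t * ψ k
small-step D ψ with any? (λ k → (0ℚ <? D k) ×-dec (0ℚ <? ψ k))
... | no none   = 1ℚ , ℚP.positive⁻¹ 1ℚ , λ k 0<Dk →
  ℚP.<-≤-trans 0<Dk (D≤D-tψ (ℚP.nonNegative⁻¹ 1ℚ) (ℚP.≮⇒≥ (λ 0<ψk → none (k , 0<Dk , 0<ψk))))
... | yes some = from-min (argmin-on (λ k → (0ℚ <? D k) ×-dec (0ℚ <? ψ k)) (λ k → D k * inv (ψ k)) some)
  where
  from-min : (∃ λ k₀ → (0ℚ < D k₀ × 0ℚ < ψ k₀) × ∀ k → 0ℚ < D k × 0ℚ < ψ k → D k₀ * inv (ψ k₀) ≤ D k * inv (ψ k)) →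
             ∃ λ t → 0ℚ < t × ∀ k → 0ℚ < D k → 0ℚ < D k - t * ψ k
  from-min (k₀ , (0<Dk₀ , 0<ψk₀) , minimal) with ℚP.<-dense (0<*0< 0<Dk₀ (inv-pos 0<ψk₀))
  ... | t , 0<t , t<D/ψ = t , 0<t , positive
    where
    positive : ∀ k → 0ℚ < D k → 0ℚ < D k - t * ψ k
    positive k 0<Dk with 0ℚ <? ψ k
    ... | yes 0<ψk = t<D/ψ⇒0<D-tψ {D k} 0<ψk (ℚP.<-≤-trans t<D/ψ (minimal k (0<Dk , 0<ψk)))
    ... | no 0≮ψk  = ℚP.<-≤-trans 0<Dk (D≤D-tψ (ℚP.<⇒≤ 0<t) (ℚP.≮⇒≥ 0≮ψk))

∷-injective : ∀ {A : Set} {m} {x : A} {f : Fin m → A} → (∀ i → f i ≢ x) →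
              Injective _≡_ _≡_ f → Injective _≡_ _≡_ (x ∷ f)
∷-injective f∌x f-inj {zero}  {zero}  _  = refl
∷-injective f∌x f-inj {zero}  {suc j} eq = contradiction (sym eq) (f∌x j)
∷-injective f∌x f-inj {suc i} {zero}  eq = contradiction eq (f∌x i)
∷-injective f∌x f-inj {suc i} {suc j} eq = cong suc (f-inj eq)

injective⇒surjective : ∀ {m} {f : Fin m → Fin m} → Injective _≡_ _≡_ f → ∀ y → ∃ λ x → f x ≡ y
injective⇒surjective {suc m} {f} f-inj y with any? (λ x → f x Fin.≟ y)
... | yes hit  = hit
... | no ¬hit = contradiction (injective⇒≤ punched-injective) (n≮n m)
  where
  y≢f : ∀ x → y ≢ f x
  y≢f x y≡fx = ¬hit (x , sym y≡fx)
  punched-injective : Injective _≡_ _≡_ (λ x → punchOut (y≢f x))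
  punched-injective eq = f-inj (punchOut-injective (y≢f _) (y≢f _) eq)

module Polytope {d n : ℕ} (p : Fin n → Point d) where

  open Supporting

  slack : Supporting p → Fin n → ℚ
  slack H k = offset H - normal H · p k

  slack-nonneg : ∀ H k → 0ℚ ≤ slack H k
  slack-nonneg H k = p≤q⇒0≤q-p (below H k)

  On⇒slack≡0 : ∀ {H k} → On H k → slack H k ≡ 0ℚ
  On⇒slack≡0 on = x≈y⇒x∙y⁻¹≈ε (sym on)

  slack≡0⇒On : ∀ {H k} → slack H k ≡ 0ℚ → On H k
  slack≡0⇒On {H} {k} slack≡0 = sym (x∙y⁻¹≈ε⇒x≈y (offset H) (normal H · p k) slack≡0)

  ¬On⇒0<slack : ∀ {H k} → ¬ On H k → 0ℚ < slack H k
  ¬On⇒0<slack {H} {k} off with ℚP.<-cmp 0ℚ (slack H k)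
  ... | tri< 0<slack _ _ = 0<slack
  ... | tri≈ _ 0≡slack _ = contradiction (slack≡0⇒On {H} {k} (sym 0≡slack)) off
  ... | tri> _ _ slack<0 = contradiction (ℚP.<-≤-trans slack<0 (slack-nonneg H k)) (ℚP.<-irrefl refl)

  On? : ∀ H k → Dec (On H k)
  On? H k = normal H · p k ≟ offset H

  IsFace : (Fin n → Set) → Set
  IsFace P = Σ (Supporting p) λ H → ∀ k → On H k ⇔ P k

  face-resp : ∀ {P Q : Fin n → Set} → IsFace P → (∀ k → P k ⇔ Q k) → IsFace Q
  face-resp (H , H⇔P) P⇔Q = H , λ k → proj₁ (P⇔Q k) ∘ proj₁ (H⇔P k) , proj₂ (H⇔P k) ∘ proj₂ (P⇔Q k)

  face-of-slack : (a : Point d) (b : ℚ) → (∀ k → 0ℚ ≤ b - a · p k) →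
                  ∀ {i j} → b - a · p i ≡ 0ℚ → b - a · p j ≢ 0ℚ → IsFace (λ k → b - a · p k ≡ 0ℚ)
  face-of-slack a b nonneg {i} {j} tight-i loose-j =
    hyp a b a≢0 (λ k → 0≤q-p⇒p≤q (nonneg k)) , λ k → x≈y⇒x∙y⁻¹≈ε ∘ sym , sym ∘ x∙y⁻¹≈ε⇒x≈y b (a · p k)
    where
    a≢0 : ¬ (∀ k → a k ≡ 0ℚ)
    a≢0 a≡0 = loose-j (trans (cong (λ y → b - y) (trans (·-zeroˡ (p j) a≡0) (sym (·-zeroˡ (p i) a≡0)))) tight-i)

  tiltedSlack : Supporting p → Point (suc d) → ℚ → Fin n → ℚ
  tiltedSlack H g t k = slack H k - t * (g · lift (p k))

  tilt : ∀ H g t → (∀ k → 0ℚ ≤ tiltedSlack H g t k) →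
         ∀ {i j} → tiltedSlack H g t i ≡ 0ℚ → tiltedSlack H g t j ≢ 0ℚ →
         IsFace (λ k → tiltedSlack H g t k ≡ 0ℚ)
  tilt H g t nonneg tight-i loose-j =
    face-resp (face-of-slack a b (λ k → subst (0ℚ ≤_) (sym (slack≡ k)) (nonneg k))
                             (trans (slack≡ _) tight-i) (loose-j ∘ trans (sym (slack≡ _))))
              (λ k → trans (sym (slack≡ k)) , trans (slack≡ k))
    where
    a : Point d
    a j = normal H j + t * g (suc j)
    b : ℚ
    b = offset H - t * head g
    slack≡ : ∀ k → b - a · p k ≡ tiltedSlack H g t k
    slack≡ k = trans (cong (λ y → b - y) (·-linearˡ (normal H) (tail g) (p k) t))
                     (regroup (offset H) t (head g) (normal H · p k) (tail g · p k))
      where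
      regroup : ∀ c t g₀ A B → (c - t * g₀) - (A + t * B) ≡ (c - A) - t * (g₀ * 1ℚ + B)
      regroup = solve 5 (λ c t g₀ A B → (c :- t :* g₀) :- (A :+ t :* B) := (c :- A) :- t :* (g₀ :* con 1ℚ :+ B)) refl

  nonvanishing : FullDimensional p → ∀ {g : Point (suc d)} → Nonzero (tail g) → ∃ λ k → g · lift (p k) ≢ 0ℚ
  nonvanishing full {g} tail≢0 with all? (λ k → g · lift (p k) ≟ 0ℚ)
  ... | no ¬vanishes = ¬∀⟶∃¬ n _ (λ k → g · lift (p k) ≟ 0ℚ) ¬vanishes
  ... | yes vanishes = contradiction (full (tail g) (- (head g * 1ℚ)) (λ k → inverseʳ-unique _ _ (vanishes k))) tail≢0

  vanishing-functional : FullDimensional p → ∀ {m} → m ℕ.< d → (q : Fin (suc m) → Fin n) →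
                         ∃ λ g → (∀ i → g · lift (p (q i)) ≡ 0ℚ) × ∃ λ k → 0ℚ < g · lift (p k)
  vanishing-functional full m<d q = from-solution (homogeneous-solution (s≤s m<d) (lift ∘ p ∘ q))
    where
    from-solution : (∃ λ G → Nonzero G × ∀ i → G · lift (p (q i)) ≡ 0ℚ) →
                    ∃ λ g → (∀ i → g · lift (p (q i)) ≡ 0ℚ) × ∃ λ k → 0ℚ < g · lift (p k)
    from-solution (G , G≢0 , G⊥q) = orient (nonvanishing full {G} tail≢0)
      where
      tail≢0 : Nonzero (tail G)
      tail≢0 tail≡0 = G≢0 λ
        { zero    → trans (sym (trans (cong (head G * 1ℚ +_) (·-zeroˡ (p (q zero)) tail≡0))
                                      (trans (ℚP.+-identityʳ _) (ℚP.*-identityʳ (head G)))))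
                          (G⊥q zero)
        ; (suc j) → tail≡0 j }
      orient : (∃ λ k → G · lift (p k) ≢ 0ℚ) → ∃ λ g → (∀ i → g · lift (p (q i)) ≡ 0ℚ) × ∃ λ k → 0ℚ < g · lift (p k)
      orient (k , Gk≢0) = scale c G , (λ i → trans (·-scaleˡ c G (lift (p (q i)))) (trans (cong (c *_) (G⊥q i)) (ℚP.*-zeroʳ c))) ,
                          k , subst (0ℚ <_) (sym (trans (·-scaleˡ c G (lift (p k))) (trans (ℚP.*-comm c (G · lift (p k))) (*-inv Gk≢0)))) (ℚP.positive⁻¹ 1ℚ)
        where
        c : ℚ
        c = inv (G · lift (p k))

  record AvoidingFace (v : Fin n) (m : ℕ) : Set where
    field
      hyperplane       : Supporting p
      vertex           : Fin m → Fin n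
      vertex-injective : Injective _≡_ _≡_ vertex
      vertex-on        : ∀ i → On hyperplane (vertex i)
      v-off            : ¬ On hyperplane v

  avoiding-face-start : ∀ {v} → Supporting p → AvoidingFace v zero
  avoiding-face-start {v} H = record
    { hyperplane       = hyp (normal H) (offset H + 1ℚ) (nonzero H) (λ k → ℚP.≤-trans (below H k) (ℚP.<⇒≤ b<b+1))
    ; vertex           = λ ()
    ; vertex-injective = λ { {()} }
    ; vertex-on        = λ ()
    ; v-off            = λ on → ℚP.<-irrefl refl (ℚP.<-≤-trans b<b+1 (subst (_≤ offset H) on (below H v)))
    }
    where
    b<b+1 : offset H < offset H + 1ℚ
    b<b+1 = subst (_< offset H + 1ℚ) (ℚP.+-identityʳ (offset H)) (ℚP.+-monoʳ-< (offset H) (ℚP.positive⁻¹ 1ℚ))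

  -- Tilt the hyperplane by g as far as the slacks allow: a new vertex is reached,
  -- while v and the vertices already on it, where g vanishes, keep their slack.
  rotate : ∀ {v m} (F : AvoidingFace v m) (g : Point (suc d)) → let open AvoidingFace F in
           g · lift (p v) ≡ 0ℚ → (∀ i → g · lift (p (vertex i)) ≡ 0ℚ) → ∃ (λ k → 0ℚ < g · lift (p k)) →
           AvoidingFace v (suc m)
  rotate {v} {m} F g g-v g-vertex positive = from-step (max-step (slack hyperplane) ψ (slack-nonneg hyperplane) positive)
    where
    open AvoidingFace F
    ψ : Fin n → ℚ
    ψ k = g · lift (p k)
    minus-zero : ∀ a t → a - t * 0ℚ ≡ a
    minus-zero = solve 2 (λ a t → a :- t :* con 0ℚ := a) refl
    σ-v : ∀ t → tiltedSlack hyperplane g t v ≡ slack hyperplane v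
    σ-v t = trans (cong (λ y → slack hyperplane v - t * y) g-v) (minus-zero _ t)
    σ-vertex : ∀ t i → tiltedSlack hyperplane g t (vertex i) ≡ 0ℚ
    σ-vertex t i = trans (cong₂ (λ x y → x - t * y) (On⇒slack≡0 {hyperplane} (vertex-on i)) (g-vertex i)) (minus-zero 0ℚ t)
    from-step : (∃₂ λ t k₀ → 0ℚ < ψ k₀ × tiltedSlack hyperplane g t k₀ ≡ 0ℚ × ∀ k → 0ℚ ≤ tiltedSlack hyperplane g t k) →
                AvoidingFace v (suc m)
    from-step (t , k₀ , 0<ψk₀ , tight , nonneg) = record
      { hyperplane       = proj₁ face
      ; vertex           = k₀ ∷ vertex
      ; vertex-injective = ∷-injective k₀-new vertex-injective
      ; vertex-on        = on
      ; v-off            = loose-v ∘ proj₁ (proj₂ face v)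
      }
      where
      loose-v : tiltedSlack hyperplane g t v ≢ 0ℚ
      loose-v = v-off ∘ slack≡0⇒On {hyperplane} ∘ trans (sym (σ-v t))
      face : IsFace (λ k → tiltedSlack hyperplane g t k ≡ 0ℚ)
      face = tilt hyperplane g t nonneg tight loose-v
      on : ∀ i → On (proj₁ face) ((k₀ ∷ vertex) i)
      on zero    = proj₂ (proj₂ face k₀) tight
      on (suc i) = proj₂ (proj₂ face (vertex i)) (σ-vertex t i)
      k₀-new : ∀ i → vertex i ≢ k₀
      k₀-new i refl = ℚP.<⇒≢ 0<ψk₀ (sym (g-vertex i))

  avoiding-face : FullDimensional p → ∀ {v} → Supporting p → ∀ m → m ℕ.≤ d → AvoidingFace v m
  avoiding-face full H zero    _   = avoiding-face-start H
  avoiding-face full {v} H (suc m) m<d = extend-face (avoiding-face full H m (ℕP.<⇒≤ m<d))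
    where
    extend-face : AvoidingFace v m → AvoidingFace v (suc m)
    extend-face F = rotate-by (vanishing-functional full m<d (v ∷ vertex))
      where
      open AvoidingFace F
      rotate-by : (∃ λ g → (∀ i → g · lift (p ((v ∷ vertex) i)) ≡ 0ℚ) × ∃ λ k → 0ℚ < g · lift (p k)) → AvoidingFace v (suc m)
      rotate-by (g , g⊥ , positive) = rotate F g (g⊥ zero) (g⊥ ∘ suc) positive

  OnExcept? : ∀ H s k → Dec (On H k × k ≢ s)
  OnExcept? H s k = On? H k ×-dec ¬? (k Fin.≟ s)

  otherLifts : Supporting p → Fin n → Fin n → Point (suc d)
  otherLifts H s k = scale (indicator (OnExcept? H s k)) (lift (p k))

  tilt-away : ∀ H {s o} (G : Point (suc d)) → On H s → On H o → o ≢ s →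
              (∀ {k} → On H k → k ≢ s → G · lift (p k) ≡ 0ℚ) → G · lift (p s) ≡ 1ℚ →
              IsFace (λ k → On H k × k ≢ s)
  tilt-away H {s} {o} G s-on o-on o≢s G-in G-s = from-step (small-step (slack H) ψ)
    where
    g : Point (suc d)
    g = scale (- 1ℚ) G
    ψ : Fin n → ℚ
    ψ k = g · lift (p k)
    ψ≡ : ∀ k → ψ k ≡ - 1ℚ * (G · lift (p k))
    ψ≡ k = ·-scaleˡ (- 1ℚ) G (lift (p k))
    from-step : (∃ λ t → 0ℚ < t × ∀ k → 0ℚ < slack H k → 0ℚ < tiltedSlack H g t k) → IsFace (λ k → On H k × k ≢ s)
    from-step (t , 0<t , positive) = face-resp (tilt H g t nonneg (σ-in o-on o≢s) (ℚP.<⇒≢ σ-s ∘ sym)) iff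
      where
      σ-in : ∀ {k} → On H k → k ≢ s → tiltedSlack H g t k ≡ 0ℚ
      σ-in {k} on k≢s = trans (cong₂ (λ a b → a - t * b) (On⇒slack≡0 {H} on) (trans (ψ≡ k) (cong (- 1ℚ *_) (G-in on k≢s)))) (vanish t)
        where
        vanish : ∀ t → 0ℚ - t * (- 1ℚ * 0ℚ) ≡ 0ℚ
        vanish = solve 1 (λ t → con 0ℚ :- t :* (:- con 1ℚ :* con 0ℚ) := con 0ℚ) refl
      σ-s : 0ℚ < tiltedSlack H g t s
      σ-s = subst (0ℚ <_) (sym (trans (cong₂ (λ a b → a - t * b) (On⇒slack≡0 {H} s-on) (trans (ψ≡ s) (cong (- 1ℚ *_) G-s))) (plus-t t))) 0<t
        where
        plus-t : ∀ t → 0ℚ - t * (- 1ℚ * 1ℚ) ≡ t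
        plus-t = solve 1 (λ t → con 0ℚ :- t :* (:- con 1ℚ :* con 1ℚ) := t) refl
      σ-out : ∀ k → ¬ (On H k × k ≢ s) → 0ℚ < tiltedSlack H g t k
      σ-out k ¬F with On? H k | k Fin.≟ s
      ... | no off  | _        = positive k (¬On⇒0<slack {H} off)
      ... | yes _   | yes refl = σ-s
      ... | yes on  | no k≢s   = contradiction (on , k≢s) ¬F
      nonneg : ∀ k → 0ℚ ≤ tiltedSlack H g t k
      nonneg k with OnExcept? H s k
      ... | yes (on , k≢s) = ℚP.≤-reflexive (sym (σ-in on k≢s))
      ... | no ¬F          = ℚP.<⇒≤ (σ-out k ¬F)
      iff : ∀ k → (tiltedSlack H g t k ≡ 0ℚ) ⇔ (On H k × k ≢ s)
      iff k = (λ σ≡0 → decidable-stable (OnExcept? H s k) (λ ¬F → ℚP.<⇒≢ (σ-out k ¬F) (sym σ≡0))) , λ (on , k≢s) → σ-in on k≢s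

  module Simplicial (simplicial : (H : Supporting p) → AffinelyIndependent p (On H)) where

    lift-not-in-span : ∀ H {s} → On H s → ¬ InSpan (otherLifts H s) (lift (p s))
    lift-not-in-span H {s} s-on (l , s≡) = contradiction (simplicial H λ′ supported sums-to-0 combines-to-0 s) λ′s≢0
      where
      ι : Fin n → ℚ
      ι k = indicator (OnExcept? H s k)
      ι-s : ι s ≡ 0ℚ
      ι-s = indicator-no (λ F → proj₂ F refl) (OnExcept? H s s)
      λ′ : Fin n → ℚ
      λ′ r = l r * ι r - δ s r
      supported : ∀ r → ¬ On H r → λ′ r ≡ 0ℚ
      supported r r-off = trans (cong₂ (λ a b → l r * a - b) (indicator-no (r-off ∘ proj₁) (OnExcept? H s r))
                                                            (δ-offdiag {r = s} {r} (λ { refl → r-off s-on })))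
                                (cong (_- 0ℚ) (ℚP.*-zeroʳ (l r)))
      sums-to-0 : ∑ λ′ ≡ 0ℚ
      sums-to-0 = begin
        ∑ λ′                                 ≡⟨ ∑-cong (λ r → cong (λ y → l r * ι r - y) (ℚP.*-identityʳ (δ s r))) ⟨
        ∑ (λ r → l r * ι r - δ s r * 1ℚ)     ≡⟨ ∑-minus-δ s (λ r → l r * ι r) (λ _ → 1ℚ) ⟩
        ∑ (λ r → l r * ι r) - 1ℚ             ≡⟨ cong (_- 1ℚ) (∑-cong (λ r → cong (l r *_) (ℚP.*-identityʳ (ι r)))) ⟨
        ∑ (λ r → l r * (ι r * 1ℚ)) - 1ℚ      ≡⟨ cong (_- 1ℚ) (s≡ zero) ⟨
        1ℚ - 1ℚ                              ≡⟨⟩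
        0ℚ                                   ∎
        where open ≡-Reasoning
      combines-to-0 : ∀ k → ∑ (λ r → λ′ r * p r k) ≡ 0ℚ
      combines-to-0 k = begin
        ∑ (λ r → λ′ r * p r k)                           ≡⟨ ∑-cong (λ r → expand (l r) (ι r) (δ s r) (p r k)) ⟩
        ∑ (λ r → l r * (ι r * p r k) - δ s r * p r k)    ≡⟨ ∑-minus-δ s (λ r → l r * (ι r * p r k)) (λ r → p r k) ⟩
        ∑ (λ r → l r * (ι r * p r k)) - p s k            ≡⟨ cong (_- p s k) (s≡ (suc k)) ⟨
        p s k - p s k                                    ≡⟨ ℚP.+-inverseʳ (p s k) ⟩
        0ℚ                                               ∎
        where
        open ≡-Reasoning
        expand : ∀ l ι δ x → (l * ι - δ) * x ≡ l * (ι * x) - δ * x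
        expand = solve 4 (λ l ι δ x → (l :* ι :- δ) :* x := l :* (ι :* x) :- δ :* x) refl
      λ′s≢0 : λ′ s ≢ 0ℚ
      λ′s≢0 λ′s≡0 = -1≢0 (trans (sym λ′s≡-1) λ′s≡0)
        where
        -1≢0 : - 1ℚ ≢ 0ℚ
        -1≢0 ()
        minus-one : ∀ a → a * 0ℚ - 1ℚ ≡ - 1ℚ
        minus-one = solve 1 (λ a → a :* con 0ℚ :- con 1ℚ := :- con 1ℚ) refl
        λ′s≡-1 : λ′ s ≡ - 1ℚ
        λ′s≡-1 = trans (cong₂ (λ a b → l s * a - b) ι-s (δ-diag s)) (minus-one (l s))

    -- Either lift (p s) is an affine combination of the other vertices of H, which affine
    -- independence forbids, or some functional separates it from them.
    hyperplane-without : ∀ H {s o} → On H s → On H o → o ≢ s → IsFace (λ k → On H k × k ≢ s)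
    hyperplane-without H {s} s-on o-on o≢s =
      Sum.[ ⊥-elim ∘ lift-not-in-span H s-on , separated ]′ (span-or-separated (otherLifts H s) (lift (p s)))
      where
      separated : (∃ λ G → Separates G (otherLifts H s) (lift (p s))) → IsFace (λ k → On H k × k ≢ s)
      separated (G , G⊥ , G·s≡1) = tilt-away H G s-on o-on o≢s G-in G·s≡1
        where
        G-in : ∀ {k} → On H k → k ≢ s → G · lift (p k) ≡ 0ℚ
        G-in {k} on k≢s = begin
          G · lift (p k)                                     ≡⟨ ℚP.*-identityˡ (G · lift (p k)) ⟨
          1ℚ * (G · lift (p k))                              ≡⟨ cong (_* (G · lift (p k))) (indicator-yes (on , k≢s) (OnExcept? H s k)) ⟨
          indicator (OnExcept? H s k) * (G · lift (p k))     ≡⟨ ·-scaleʳ (indicator (OnExcept? H s k)) G (lift (p k)) ⟨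
          G · otherLifts H s k                               ≡⟨ G⊥ k ⟩
          0ℚ                                                 ∎
          where open ≡-Reasoning

    face-without : ∀ {P s o} → IsFace P → P o → o ≢ s → IsFace (λ k → P k × k ≢ s)
    face-without {P} {s} {o} (H , H⇔P) Po o≢s with On? H s
    ... | no s-off = face-resp (H , H⇔P) λ k → (λ Pk → Pk , λ { refl → s-off (proj₂ (H⇔P k) Pk) }) , proj₁
    ... | yes s-on = face-resp (hyperplane-without H s-on (proj₂ (H⇔P o) Po) o≢s)
                               λ k → map₁ (proj₁ (H⇔P k)) , map₁ (proj₂ (H⇔P k))

    face-without-all : ∀ {P o} → IsFace P → P o → (xs : List (Fin n)) → o ∉ xs → IsFace (λ k → P k × k ∉ xs)
    face-without-all F Po []            _   = face-resp F λ k → (_, λ ()) , proj₁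
    face-without-all F Po (x List.∷ xs) o∉ =
      face-resp (face-without (face-without-all F Po xs (o∉ ∘ there)) (Po , o∉ ∘ there) (o∉ ∘ here))
                λ k → (λ { ((Pk , k∉xs) , k≢x) → Pk , λ { (here k≡x) → k≢x k≡x ; (there k∈xs) → k∉xs k∈xs } })
                    , (λ { (Pk , k∉) → (Pk , k∉ ∘ there) , k∉ ∘ here })

    subface : ∀ {P Q : Fin n → Set} {o} → IsFace P → Decidable Q → (∀ k → Q k → P k) → Q o → IsFace Q
    subface {P} {Q} {o} F Q? Q⊆P Qo =
      face-resp (face-without-all F (Q⊆P o Qo) outside (∉outside⇔Q o .proj₂ Qo)) λ k → ∉outside⇔Q k .proj₁ ∘ proj₂ , λ Qk → Q⊆P k Qk , ∉outside⇔Q k .proj₂ Qk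
      where
      outside : List (Fin n)
      outside = filter (¬? ∘ Q?) (allFin n)
      ∉outside⇔Q : ∀ k → (k ∉ outside) ⇔ Q k
      ∉outside⇔Q k = (λ k∉ → decidable-stable (Q? k) (k∉ ∘ ∈-filter⁺ (¬? ∘ Q?) (∈-allFin k)))
                   , (λ Qk k∈ → proj₂ (∈-filter⁻ (¬? ∘ Q?) {xs = allFin n} k∈) Qk)

    edge-on-hyperplane : ∀ H {i j} → On H i → On H j → i ≢ j → IsEdge p i j
    edge-on-hyperplane H {i} {j} i-on j-on i≢j =
      i≢j , subface (H , λ k → id , id) (λ k → (k Fin.≟ i) ⊎-dec (k Fin.≟ j))
                    (λ { k (inj₁ refl) → i-on ; k (inj₂ refl) → j-on }) (inj₁ refl)

mainTheorem12 : (d n : ℕ) (p : Fin n → Point d) →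
    SimplicialPolytope d n p → Balanced d n p →
    (v : Fin n) → IsVertex p v →
    ∃ λ (u : Fin n) → IsVertex p u × u ≢ v × ¬ IsEdge p u v
mainTheorem12 d n p polytope (colour , proper) v v-vertex = u , allVertices u , u≢v , ¬edge
  where
  open SimplicialPolytope polytope
  open Polytope p
  open Simplicial simplicial
  open AvoidingFace (avoiding-face fullDim {v} (proj₁ v-vertex) d ℕP.≤-refl)
  colour-injective : Injective _≡_ _≡_ (colour ∘ vertex)
  colour-injective {i} {j} same with i Fin.≟ j
  ... | yes i≡j = i≡j
  ... | no i≢j  = contradiction same
                    (proper _ _ (edge-on-hyperplane hyperplane (vertex-on i) (vertex-on j) (i≢j ∘ vertex-injective)))
  hit : ∃ λ i → colour (vertex i) ≡ colour v
  hit = injective⇒surjective colour-injective (colour v)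
  u : Fin n
  u = vertex (proj₁ hit)
  u≢v : u ≢ v
  u≢v u≡v = v-off (subst (On hyperplane) u≡v (vertex-on (proj₁ hit)))
  ¬edge : ¬ IsEdge p u v
  ¬edge uv = proper u v uv (proj₂ hit)
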